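{- Let $n\ge 3$ and $m\ge 2$ be integers and consider the wheel-based self-similar graphs $G^{(i)}=G^{(i,m,n)}$ defined in the context. For $k\ge 0$ let $|V^{(k)}|$ and $|E^{(k)}|$ denote the number of vertices and edges of $G^{(k-1)}$, where $G^{(-1)}$ is a single vertex (so $|V^{(0)}|=1$, $|E^{(0)}|=0$, $|V^{(1)}|=n+1$, $|E^{(1)}|=2n$). Then for all $i\ge 1$, $$|V^{(i)}|=(n+1)|V^{(i-1)}|+(m-1)|E^{(i-1)}|,\qquad |E^{(i)}|=2n|V^{(i-1)}|+m|E^{(i-1)}|,$$ and for all $i\ge 2$, $$|V^{(i)}|=(n+m+1)|V^{(i-1)}|+(mn-m-2n)|V^{(i-2)}|,\qquad |E^{(i)}|=(n+m+1)|E^{(i-1)}|+(mn-m-2n)|E^{(i-2)}|.$$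
   Context: $W_n$ denotes the wheel with $n+1$ vertices and $2n$ edges: a cycle $C_n$ (the rim) together with a hub vertex adjacent to all rim vertices. The edge-path transformation replaces every edge of a graph by a path of length $m$ (inserting $m-1$ new internal vertices on each edge). The wheel-based model: $G^{(0)}=W_n$, and for $i\ge 0$, $G^{(i+1)}$ is obtained from $G^{(i)}$ by first applying the edge-path transformation, and then, for every vertex $v$ of $G^{(i)}$ (i.e. every vertex present before the subdivision), attaching a new copy of $W_n$ by identifying $v$ with a rim (non-hub) vertex of that copy. -}

module Defs where

open import Data.Nat using (ℕ; zero; suc; _+_; _*_; _∸_)
open import Data.Nat.DivMod using (_%_; m%n<n)
open import Data.Fin using (Fin; zero; suc; toℕ; fromℕ; fromℕ<; inject₁; _↑ˡ_; _↑ʳ_; combine)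
open import Data.List using (List; []; _∷_; _++_; map; length; allFin; lookup; concatMap; [_])
open import Data.Product using (_×_; _,_)

-- A finite (multi)graph: vertex set Fin nv, edge list of (unordered) pairs.
-- |V| = nv, |E| = length edges.
record Graph : Set where
  constructor mkGraph
  field
    nv    : ℕ
    edges : List (Fin nv × Fin nv)
open Graph public

sucMod : ∀ {k} → Fin (suc k) → Fin (suc k)
sucMod {k} i = fromℕ< (m%n<n (suc (toℕ i)) (suc k))

-- Wheel W_n: vertices Fin (suc n); rim vertices inject₁ i (i : Fin n),
-- hub = fromℕ n.  Edges: rim cycle i -- i+1 (mod n) and spokes i -- hub.
wheelEdges : (n : ℕ) → List (Fin (suc n) × Fin (suc n))
wheelEdges zero = []
wheelEdges (suc k) =
  map (λ i → (inject₁ i , inject₁ (sucMod i))) (allFin (suc k))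
  ++ map (λ i → (inject₁ i , fromℕ (suc k))) (allFin (suc k))

wheel : ℕ → Graph
wheel n = mkGraph (suc n) (wheelEdges n)

consec : {A : Set} → List A → List (A × A)
consec [] = []
consec (x ∷ []) = []
consec (x ∷ y ∷ r) = (x , y) ∷ consec (y ∷ r)

-- Edge-path transformation: every edge replaced by a path of length m
-- (m ∸ 1 new internal vertices per edge).
subdivide : ℕ → Graph → Graph
subdivide m (mkGraph nv es) =
  mkGraph (nv + length es * (m ∸ 1)) (concatMap pathE (allFin (length es)))
  where
  pathE : Fin (length es) → List (Fin (nv + length es * (m ∸ 1)) × Fin (nv + length es * (m ∸ 1)))
  pathE j with lookup es j
  ... | (u , v) =
    consec ((u ↑ˡ _) ∷ (map (λ t → nv ↑ʳ combine j t) (allFin (m ∸ 1)) ++ [ v ↑ˡ _ ]))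

-- For each of the first `old` vertices v of G, attach a new copy of W_n by
-- identifying v with the rim vertex 0 of the copy (the other n wheel
-- vertices, i.e. suc w for w : Fin n, are new).
attachWheels : (n old : ℕ) → (G : Graph) → (Fin old → Fin (nv G)) → Graph
attachWheels n old (mkGraph N es) emb =
  mkGraph (N + old * n) (map liftE es ++ concatMap copyE (allFin old))
  where
  liftE : Fin N × Fin N → Fin (N + old * n) × Fin (N + old * n)
  liftE (a , b) = (a ↑ˡ _ , b ↑ˡ _)
  copyE : Fin old → List (Fin (N + old * n) × Fin (N + old * n))
  copyE v = map (λ e → (f (Data.Product.proj₁ e) , f (Data.Product.proj₂ e))) (wheelEdges n)
    where
    f : Fin (suc n) → Fin (N + old * n)
    f zero = emb v ↑ˡ _
    f (suc w) = N ↑ʳ combine v w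

step : (m n : ℕ) → Graph → Graph
step m n G = attachWheels n (nv G) (subdivide m G) (λ v → v ↑ˡ _)

wheelModel : (m n : ℕ) → ℕ → Graph
wheelModel m n zero = wheel n
wheelModel m n (suc i) = step m n (wheelModel m n i)

shifted : (m n : ℕ) → ℕ → Graph
shifted m n zero = mkGraph 1 []
shifted m n (suc k) = wheelModel m n k

Vc : (m n k : ℕ) → ℕ
Vc m n k = nv (shifted m n k)

Ec : (m n k : ℕ) → ℕ
Ec m n k = length (edges (shifted m n k))

{-# OPTIONS --safe #-}
-- Subdividing keeps the old vertices, adds m − 1 vertices per edge and turns every edge
-- into m edges; attaching a wheel at each old vertex adds n vertices and 2n edges. So
-- (|V|, |E|) evolves by the matrix A = [[n+1, m−1], [2n, m]], and by Cayley–Hamilton both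
-- coordinates satisfy x_{i+2} = tr A · x_{i+1} − det A · x_i, where tr A = n + m + 1 and
-- det A = m + 2n − mn.
module Submission where

open import Defs
open import Data.Nat using (ℕ; zero; suc; _+_; _*_; _∸_; _≤_)
open import Data.Nat.Properties using (+-comm; +-identityʳ)
open import Data.Integer using (ℤ; +_) renaming (_+_ to _+ℤ_; _*_ to _*ℤ_; _-_ to _-ℤ_)
open import Data.Integer.Properties using (pos-+; pos-*)
open import Data.Fin using (Fin)
open import Data.Product using (_×_; _,_)
open import Data.List using (List; []; _∷_; _++_; [_]; length; map; concatMap; allFin)
open import Data.List.Properties using (length-map; length-++; length-tabulate)
open import Relation.Binary.PropositionalEquality
  using (_≡_; refl; sym; trans; cong; cong₂; module ≡-Reasoning)
import Data.Nat.Tactic.RingSolver as ℕ-Solver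
import Data.Integer.Tactic.RingSolver as ℤ-Solver

private
  variable
    A B : Set

length-allFin : ∀ n → length (allFin n) ≡ n
length-allFin n = length-tabulate (λ i → i)

length-map-allFin : ∀ {n} (f : Fin n → A) → length (map f (allFin n)) ≡ n
length-map-allFin {n = n} f = trans (length-map f (allFin n)) (length-allFin n)

length-consec : ∀ (x : A) xs → length (consec (x ∷ xs)) ≡ length xs
length-consec x []       = refl
length-consec x (y ∷ xs) = cong suc (length-consec y xs)

length-consec-path : ∀ (u v : A) xs → length (consec (u ∷ xs ++ [ v ])) ≡ suc (length xs)
length-consec-path u v xs =
  trans (length-consec u (xs ++ [ v ])) (trans (length-++ xs) (+-comm (length xs) 1))

length-concatMap-const : ∀ (f : A → List B) {c} → (∀ a → length (f a) ≡ c) →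
                         ∀ xs → length (concatMap f xs) ≡ length xs * c
length-concatMap-const f f-const []       = refl
length-concatMap-const f f-const (x ∷ xs) =
  trans (length-++ (f x)) (cong₂ _+_ (f-const x) (length-concatMap-const f f-const xs))

length-wheelEdges : ∀ n → length (wheelEdges n) ≡ 2 * n
length-wheelEdges zero    = refl
length-wheelEdges (suc n) =
  trans (length-++ (map _ (allFin (suc n))))
        (cong₂ _+_ (length-map-allFin {n = suc n} _)
                   (trans (length-map-allFin {n = suc n} _) (sym (+-identityʳ (suc n)))))

length-edges-subdivide : ∀ m G → length (edges (subdivide (suc m) G)) ≡ length (edges G) * suc m
length-edges-subdivide m (mkGraph V es) =
  trans (length-concatMap-const _
           (λ j → trans (length-consec-path _ _ (map _ (allFin m))) (cong suc (length-map-allFin _)))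
           (allFin (length es)))
        (cong (_* suc m) (length-allFin (length es)))

length-edges-attachWheels : ∀ n old G (emb : Fin old → Fin (nv G)) →
  length (edges (attachWheels n old G emb)) ≡ length (edges G) + old * (2 * n)
length-edges-attachWheels n old (mkGraph N es) emb =
  trans (length-++ (map _ es))
        (cong₂ _+_ (length-map _ es)
                   (trans (length-concatMap-const _
                                   (λ v → trans (length-map _ (wheelEdges n)) (length-wheelEdges n))
                                   (allFin old))
                          (cong (_* (2 * n)) (length-allFin old))))

nv-step : ∀ m n G → nv (step m n G) ≡ (n + 1) * nv G + (m ∸ 1) * length (edges G)
nv-step m n (mkGraph V es) = rearrange V (length es) (m ∸ 1) n
  where
  rearrange : ∀ V E k n → V + E * k + V * n ≡ (n + 1) * V + k * E
  rearrange = ℕ-Solver.solve-∀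

length-edges-step : ∀ m n G →
  length (edges (step (suc m) n G)) ≡ (2 * n) * nv G + suc m * length (edges G)
length-edges-step m n G =
  trans (length-edges-attachWheels n (nv G) (subdivide (suc m) G) _)
        (trans (cong (_+ nv G * (2 * n)) (length-edges-subdivide m G))
               (rearrange (length (edges G)) (nv G) (suc m) (2 * n)))
  where
  rearrange : ∀ E V k c → E * k + V * c ≡ c * V + k * E
  rearrange = ℕ-Solver.solve-∀

Vc-suc : ∀ m n i → Vc m n (1 + i) ≡ (n + 1) * Vc m n i + (m ∸ 1) * Ec m n i
Vc-suc m n zero    = wheel-size n (m ∸ 1)
  where
  wheel-size : ∀ n k → suc n ≡ (n + 1) * 1 + k * 0
  wheel-size = ℕ-Solver.solve-∀
Vc-suc m n (suc i) = nv-step m n (wheelModel m n i)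

Ec-suc : ∀ m n i → Ec (suc m) n (1 + i) ≡ (2 * n) * Vc (suc m) n i + suc m * Ec (suc m) n i
Ec-suc m n zero    = trans (length-wheelEdges n) (wheel-size (2 * n) (suc m))
  where
  wheel-size : ∀ c k → c ≡ c * 1 + k * 0
  wheel-size = ℕ-Solver.solve-∀
Ec-suc m n (suc i) = length-edges-step m n (wheelModel (suc m) n i)

module CayleyHamilton (a b c d : ℤ) (x y : ℕ → ℤ)
         (x-suc : ∀ i → x (suc i) ≡ a *ℤ x i +ℤ b *ℤ y i)
         (y-suc : ∀ i → y (suc i) ≡ c *ℤ x i +ℤ d *ℤ y i) where
  open ≡-Reasoning

  x-second-order : ∀ i → x (2 + i) ≡ (a +ℤ d) *ℤ x (1 + i) +ℤ (b *ℤ c -ℤ a *ℤ d) *ℤ x i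
  x-second-order i = begin
      x (2 + i)
    ≡⟨ x-suc (1 + i) ⟩
      a *ℤ x (1 + i) +ℤ b *ℤ y (1 + i)
    ≡⟨ cong₂ (λ p q → a *ℤ p +ℤ b *ℤ q) (x-suc i) (y-suc i) ⟩
      a *ℤ (a *ℤ x i +ℤ b *ℤ y i) +ℤ b *ℤ (c *ℤ x i +ℤ d *ℤ y i)
    ≡⟨ identity a b c d (x i) (y i) ⟩
      (a +ℤ d) *ℤ (a *ℤ x i +ℤ b *ℤ y i) +ℤ (b *ℤ c -ℤ a *ℤ d) *ℤ x i
    ≡⟨ cong (λ p → (a +ℤ d) *ℤ p +ℤ (b *ℤ c -ℤ a *ℤ d) *ℤ x i) (x-suc i) ⟨
      (a +ℤ d) *ℤ x (1 + i) +ℤ (b *ℤ c -ℤ a *ℤ d) *ℤ x i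
    ∎
    where
    identity : ∀ a b c d x y →
      a *ℤ (a *ℤ x +ℤ b *ℤ y) +ℤ b *ℤ (c *ℤ x +ℤ d *ℤ y)
        ≡ (a +ℤ d) *ℤ (a *ℤ x +ℤ b *ℤ y) +ℤ (b *ℤ c -ℤ a *ℤ d) *ℤ x
    identity = ℤ-Solver.solve-∀

  y-second-order : ∀ i → y (2 + i) ≡ (a +ℤ d) *ℤ y (1 + i) +ℤ (b *ℤ c -ℤ a *ℤ d) *ℤ y i
  y-second-order i = begin
      y (2 + i)
    ≡⟨ y-suc (1 + i) ⟩
      c *ℤ x (1 + i) +ℤ d *ℤ y (1 + i)
    ≡⟨ cong₂ (λ p q → c *ℤ p +ℤ d *ℤ q) (x-suc i) (y-suc i) ⟩
      c *ℤ (a *ℤ x i +ℤ b *ℤ y i) +ℤ d *ℤ (c *ℤ x i +ℤ d *ℤ y i)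
    ≡⟨ identity a b c d (x i) (y i) ⟩
      (a +ℤ d) *ℤ (c *ℤ x i +ℤ d *ℤ y i) +ℤ (b *ℤ c -ℤ a *ℤ d) *ℤ y i
    ≡⟨ cong (λ q → (a +ℤ d) *ℤ q +ℤ (b *ℤ c -ℤ a *ℤ d) *ℤ y i) (y-suc i) ⟨
      (a +ℤ d) *ℤ y (1 + i) +ℤ (b *ℤ c -ℤ a *ℤ d) *ℤ y i
    ∎
    where
    identity : ∀ a b c d x y →
      c *ℤ (a *ℤ x +ℤ b *ℤ y) +ℤ d *ℤ (c *ℤ x +ℤ d *ℤ y)
        ≡ (a +ℤ d) *ℤ (c *ℤ x +ℤ d *ℤ y) +ℤ (b *ℤ c -ℤ a *ℤ d) *ℤ y
    identity = ℤ-Solver.solve-∀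

pos-linear : ∀ q r s t → + (q * r + s * t) ≡ + q *ℤ + r +ℤ + s *ℤ + t
pos-linear q r s t =
  trans (pos-+ (q * r) (s * t)) (cong₂ _+ℤ_ (pos-* q r) (pos-* s t))

wheelModel-trace : ∀ m n → + (n + 1) +ℤ + suc m ≡ + (n + suc m + 1)
wheelModel-trace m n = trans (sym (pos-+ (n + 1) (suc m))) (cong +_ (swap n (suc m)))
  where
  swap : ∀ n k → n + 1 + k ≡ n + k + 1
  swap = ℕ-Solver.solve-∀

wheelModel-det : ∀ m n →
  + m *ℤ + (2 * n) -ℤ + (n + 1) *ℤ + suc m ≡ (+ (suc m * n) -ℤ + suc m) -ℤ + (2 * n)
wheelModel-det m n = begin
    + m *ℤ + (2 * n) -ℤ + (n + 1) *ℤ + suc m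
  ≡⟨ cong₂ (λ p q → + m *ℤ p -ℤ q) (pos-* 2 n) (cong₂ _*ℤ_ (pos-+ n 1) (pos-+ 1 m)) ⟩
    + m *ℤ (+ 2 *ℤ + n) -ℤ (+ n +ℤ + 1) *ℤ (+ 1 +ℤ + m)
  ≡⟨ identity (+ m) (+ n) ⟩
    ((+ 1 +ℤ + m) *ℤ + n -ℤ (+ 1 +ℤ + m)) -ℤ + 2 *ℤ + n
  ≡⟨ cong (λ k → (k *ℤ + n -ℤ k) -ℤ + 2 *ℤ + n) (pos-+ 1 m) ⟨
    (+ suc m *ℤ + n -ℤ + suc m) -ℤ + 2 *ℤ + n
  ≡⟨ cong₂ (λ p q → (p -ℤ + suc m) -ℤ q) (pos-* (suc m) n) (pos-* 2 n) ⟨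
    (+ (suc m * n) -ℤ + suc m) -ℤ + (2 * n)
  ∎
  where
  open ≡-Reasoning
  identity : ∀ M N → M *ℤ (+ 2 *ℤ N) -ℤ (N +ℤ + 1) *ℤ (+ 1 +ℤ M)
                       ≡ ((+ 1 +ℤ M) *ℤ N -ℤ (+ 1 +ℤ M)) -ℤ + 2 *ℤ N
  identity = ℤ-Solver.solve-∀

lemma4 : (n m : ℕ) → 3 ≤ n → 2 ≤ m →
    ((i : ℕ) → Vc m n (1 + i) ≡ (n + 1) * Vc m n i + (m ∸ 1) * Ec m n i)
    × ((i : ℕ) → Ec m n (1 + i) ≡ (2 * n) * Vc m n i + m * Ec m n i)
    × ((i : ℕ) → + Vc m n (2 + i) ≡ + (n + m + 1) *ℤ + Vc m n (1 + i) +ℤ ((+ (m * n) -ℤ + m) -ℤ + (2 * n)) *ℤ + Vc m n i)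
    × ((i : ℕ) → + Ec m n (2 + i) ≡ + (n + m + 1) *ℤ + Ec m n (1 + i) +ℤ ((+ (m * n) -ℤ + m) -ℤ + (2 * n)) *ℤ + Ec m n i)
lemma4 n zero    _ ()
lemma4 n (suc m) _ _ =
  Vc-suc (suc m) n , Ec-suc m n ,
  (λ i → trans (x-second-order i) (wheel-coefficients (V (1 + i)) (V i))) ,
  (λ i → trans (y-second-order i) (wheel-coefficients (E (1 + i)) (E i)))
  where
  V E : ℕ → ℤ
  V i = + Vc (suc m) n i
  E i = + Ec (suc m) n i

  V-suc : ∀ i → V (suc i) ≡ + (n + 1) *ℤ V i +ℤ + m *ℤ E i
  V-suc i = trans (cong +_ (Vc-suc (suc m) n i)) (pos-linear (n + 1) _ m _)

  E-suc : ∀ i → E (suc i) ≡ + (2 * n) *ℤ V i +ℤ + suc m *ℤ E i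
  E-suc i = trans (cong +_ (Ec-suc m n i)) (pos-linear (2 * n) _ (suc m) _)

  open CayleyHamilton (+ (n + 1)) (+ m) (+ (2 * n)) (+ suc m) V E V-suc E-suc

  wheel-coefficients : ∀ u v →
    (+ (n + 1) +ℤ + suc m) *ℤ u +ℤ (+ m *ℤ + (2 * n) -ℤ + (n + 1) *ℤ + suc m) *ℤ v
      ≡ + (n + suc m + 1) *ℤ u +ℤ ((+ (suc m * n) -ℤ + suc m) -ℤ + (2 * n)) *ℤ v
  wheel-coefficients u v =
    cong₂ (λ t s → t *ℤ u +ℤ s *ℤ v) (wheelModel-trace m n) (wheelModel-det m n)
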